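{- Let $n$ and $N$ be positive even integers with $N\ge n$, and let $P\in\{P_n^{<,<},P_n^{>,>},P_n^{<,>},P_n^{>,<}\}$. Then \[ \mathrm{ex}_<(N/2,N/2,P)=\left(\frac n2-1\right)\left(N-\frac n2+1\right). \]
   Context: An ordered graph is a graph whose vertex set is equipped with a total order; ordered graphs on $[m]=\{1,\dots,m\}$ use the natural order of the integers. An ordered graph $G$ contains an ordered graph $H$ if there is an injection $f:V(H)\to V(G)$ such that $f(i)<f(j)$ whenever $i<j$, and $f(i)f(j)\in E(G)$ whenever $ij\in E(H)$; otherwise $G$ avoids $H$. For a positive integer $M$, the ordered bipartite Turán number $\mathrm{ex}_<(M,M,H)$ is the maximum number of edges of an ordered graph on vertex set $[2M]$ all of whose edges join a vertex of $[1,M]$ to a vertex of $[M+1,2M]$, and which avoids $H$. For $n=2k$ even, the ordered paths $P_n^{r_1,r_2}$ on $[n]$ are defined by their vertex sequences $v_1,\dots,v_n$ along the path, for $j=1,\dots,k$: $P_n^{<,<}$: $v_{2j-1}=j$, $v_{2j}=k+j$; $P_n^{>,>}$: $v_{2j-1}=k+1-j$, $v_{2j}=2k+1-j$; $P_n^{<,>}$: $v_{2j-1}=j$, $v_{2j}=2k+1-j$ (this is the alternating path $1,n,2,n-1,\dots$); $P_n^{>,<}$: $v_{2j-1}=k+1-j$, $v_{2j}=k+j$. -}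

module Defs where

open import Data.Nat using (ℕ; zero; suc; _+_; _*_; _∸_; _≤_; _<_; _<ᵇ_)
open import Data.Fin using (Fin; toℕ)
open import Data.Bool using (Bool; true; false; _∧_; if_then_else_)
open import Data.List using (List; map; allFin)
open import Data.Nat.ListAction using (sum)
open import Data.Product using (Σ; ∃; _×_; _,_)
open import Data.Sum using (_⊎_)
open import Relation.Binary.PropositionalEquality using (_≡_)
open import Relation.Nullary using (¬_)

-- Convention: a vertex a : Fin m of an ordered graph on [m] stands for the
-- integer toℕ a + 1 ∈ [m]; the order is the natural one.

record OrderedGraph (m : ℕ) : Set where
  field
    adj   : Fin m → Fin m → Bool
    sym   : ∀ i j → adj i j ≡ adj j i
    irrefl : ∀ i → adj i i ≡ false
open OrderedGraph public

edgeCount : {m : ℕ} → OrderedGraph m → ℕ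
edgeCount {m} G =
  sum (map (λ i → sum (map (λ j →
         if (toℕ i <ᵇ toℕ j) ∧ adj G i j then 1 else 0) (allFin m))) (allFin m))

BipartiteSplit : (M : ℕ) → OrderedGraph (2 * M) → Set
BipartiteSplit M G = ∀ i j → adj G i j ≡ true →
  ((toℕ i < M) × (M ≤ toℕ j)) ⊎ ((toℕ j < M) × (M ≤ toℕ i))

-- The four orderings of the path P_n^{r1,r2}, n = 2k.
data PathType : Set where
  ll gg lg gl : PathType   -- <,<   >,>   <,>   >,<

-- v_{2j-1} (odd positions) and v_{2j} (even positions), 1-indexed, for j = 1..k
oddV : PathType → ℕ → ℕ → ℕ
oddV ll k j = j
oddV gg k j = k + 1 ∸ j
oddV lg k j = j
oddV gl k j = k + 1 ∸ j

evenV : PathType → ℕ → ℕ → ℕ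
evenV ll k j = k + j
evenV gg k j = 2 * k + 1 ∸ j
evenV lg k j = 2 * k + 1 ∸ j
evenV gl k j = k + j

SamePair : ℕ → ℕ → ℕ → ℕ → Set
SamePair a b c d = ((a ≡ c) × (b ≡ d)) ⊎ ((a ≡ d) × (b ≡ c))

-- Edge relation of P_{2k}^{t} on [2k] (integers a, b in [1,2k]):
-- consecutive vertices of v_1,...,v_{2k}, i.e. v_{2j-1}v_{2j} (1 ≤ j ≤ k)
-- and v_{2j}v_{2j+1} (1 ≤ j ≤ k-1).
PathEdgeℕ : PathType → ℕ → ℕ → ℕ → Set
PathEdgeℕ t k a b =
  ∃ λ j → (1 ≤ j) ×
    (((j ≤ k) × SamePair a b (oddV t k j) (evenV t k j))
     ⊎ ((j + 1 ≤ k) × SamePair a b (evenV t k j) (oddV t k (j + 1))))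

PathEdge : PathType → (k : ℕ) → Fin (2 * k) → Fin (2 * k) → Set
PathEdge t k a b = PathEdgeℕ t k (toℕ a + 1) (toℕ b + 1)

ContainsPath : {m : ℕ} → OrderedGraph m → PathType → ℕ → Set
ContainsPath {m} G t k =
  Σ (Fin (2 * k) → Fin m) λ f →
    (∀ a b → toℕ a < toℕ b → toℕ (f a) < toℕ (f b)) ×
    (∀ a b → PathEdge t k a b → adj G (f a) (f b) ≡ true)

AvoidsPath : {m : ℕ} → OrderedGraph m → PathType → ℕ → Set
AvoidsPath G t k = ¬ ContainsPath G t k

ExBipEquals : (M : ℕ) → PathType → (k : ℕ) → ℕ → Set
ExBipEquals M t k v =
  (Σ (OrderedGraph (2 * M)) λ G →
      BipartiteSplit M G × AvoidsPath G t k × (edgeCount G ≡ v))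
  × (∀ (G : OrderedGraph (2 * M)) →
      BipartiteSplit M G → AvoidsPath G t k → edgeCount G ≤ v)

{-# OPTIONS --safe #-}

-- Write n = 2k and K = N/2.  A K-K bipartite ordered graph is a K × K 0/1 matrix, and after
-- transposing it or reversing the order of one side, a copy of P_{2k}^t is a staircase of
-- length k: ones at (a₀,b₀), (a₁,b₀), (a₁,b₁), (a₂,b₁), … with a₀ < a₁ < … and b₀ < b₁ < ….
-- Call a one deep if a staircase of length 2 ends at it.  Every other one is the first one of
-- its column or the last non-deep one of its row (and then not in row 0), so there are at most
-- 2K - 1 of them; the deep ones avoid row and column 0, and a staircase of length k - 1 among
-- them extends to one of length k.  By induction a matrix without such staircases has at most
-- (2K - 1) + (2K - 3) + … = (k - 1)(2K - k + 1) ones.  Conversely, deleting from the complete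
-- bipartite graph the (K - k + 1)-square in the corner that must contain the first edge v₁v₂
-- of every copy of P_{2k}^t leaves K² - (K - k + 1)² = (k - 1)(2K - k + 1) edges.
module Submission where

open import Defs hiding (sym)
open import Data.Nat using (ℕ; zero; suc; _+_; _*_; _∸_; _≤_; _<_; _<ᵇ_; z≤n; s≤s; z<s; s<s; s≤s⁻¹; _<?_)
open import Data.Nat.Properties
open import Data.Nat.Tactic.RingSolver using (solve-∀)
open import Algebra.Properties.CommutativeSemigroup +-commutativeSemigroup using (interchange)
open import Data.Bool using (Bool; true; false; _∧_; _∨_; not; if_then_else_; T)
open import Data.Bool.Properties using (∨-zeroʳ; ∨-identityʳ; ∨-comm)
open import Data.Fin using (Fin; toℕ; fromℕ<) renaming (zero to fzero; suc to fsuc)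
open import Data.Fin.Properties using (fromℕ<-toℕ; toℕ-fromℕ<; toℕ<n)
open import Data.List using (map; allFin; tabulate)
open import Data.List.Properties using (map-tabulate)
open import Data.Nat.ListAction using (sum)
open import Data.Product using (Σ; ∃; ∃₂; _×_; _,_; proj₁; proj₂)
open import Data.Sum using (_⊎_; inj₁; inj₂; swap)
open import Data.Empty using (⊥; ⊥-elim)
open import Data.Unit using (tt)
open import Function using (_∘_)
open import Relation.Nullary using (¬_; yes; no)
open import Relation.Binary.PropositionalEquality

∑< : ℕ → (ℕ → ℕ) → ℕ
∑< zero    f = 0
∑< (suc n) f = f 0 + ∑< n (f ∘ suc)

syntax ∑< n (λ i → x) = ∑[ i < n ] x

∑-cong : ∀ n {f g : ℕ → ℕ} → (∀ i → i < n → f i ≡ g i) → ∑< n f ≡ ∑< n g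
∑-cong zero    f≡g = refl
∑-cong (suc n) f≡g = cong₂ _+_ (f≡g 0 z<s) (∑-cong n (λ i i<n → f≡g (suc i) (s<s i<n)))

∑-mono-≤ : ∀ n {f g : ℕ → ℕ} → (∀ i → i < n → f i ≤ g i) → ∑< n f ≤ ∑< n g
∑-mono-≤ zero    f≤g = z≤n
∑-mono-≤ (suc n) f≤g = +-mono-≤ (f≤g 0 z<s) (∑-mono-≤ n (λ i i<n → f≤g (suc i) (s<s i<n)))

∑-const : ∀ n c → ∑[ i < n ] c ≡ n * c
∑-const zero    c = refl
∑-const (suc n) c = cong (c +_) (∑-const n c)

∑-≡0 : ∀ n {f : ℕ → ℕ} → (∀ i → i < n → f i ≡ 0) → ∑< n f ≡ 0
∑-≡0 n {f} f≡0 = trans (∑-cong n f≡0) (trans (∑-const n 0) (*-zeroʳ n))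

∑-≤-length : ∀ n {f : ℕ → ℕ} → (∀ i → i < n → f i ≤ 1) → ∑< n f ≤ n
∑-≤-length n {f} f≤1 = begin
  ∑< n f        ≤⟨ ∑-mono-≤ n f≤1 ⟩
  ∑[ i < n ] 1  ≡⟨ ∑-const n 1 ⟩
  n * 1         ≡⟨ *-identityʳ n ⟩
  n             ∎
  where open ≤-Reasoning

∑-distrib-+ : ∀ n (f g : ℕ → ℕ) → ∑[ i < n ] (f i + g i) ≡ ∑< n f + ∑< n g
∑-distrib-+ zero    f g = refl
∑-distrib-+ (suc n) f g =
  trans (cong (f 0 + g 0 +_) (∑-distrib-+ n (f ∘ suc) (g ∘ suc)))
        (interchange (f 0) (g 0) (∑< n (f ∘ suc)) (∑< n (g ∘ suc)))

∑∑-distrib-+ : ∀ n (f g : ℕ → ℕ → ℕ) →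
  ∑[ a < n ] ∑[ b < n ] (f a b + g a b) ≡ ∑[ a < n ] ∑[ b < n ] f a b + ∑[ a < n ] ∑[ b < n ] g a b
∑∑-distrib-+ n f g =
  trans (∑-cong n (λ a _ → ∑-distrib-+ n (f a) (g a))) (∑-distrib-+ n (λ a → ∑< n (f a)) (λ a → ∑< n (g a)))

∑-comm : ∀ n m (g : ℕ → ℕ → ℕ) → ∑[ a < n ] ∑[ b < m ] g a b ≡ ∑[ b < m ] ∑[ a < n ] g a b
∑-comm zero    m g = sym (∑-≡0 m (λ _ _ → refl))
∑-comm (suc n) m g = begin
  ∑[ b < m ] g 0 b + ∑[ a < n ] ∑[ b < m ] g (suc a) b  ≡⟨ cong (∑[ b < m ] g 0 b +_) (∑-comm n m (g ∘ suc)) ⟩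
  ∑[ b < m ] g 0 b + ∑[ b < m ] ∑[ a < n ] g (suc a) b
    ≡⟨ ∑-distrib-+ m (g 0) (λ b → ∑[ a < n ] g (suc a) b) ⟨
  ∑[ b < m ] (g 0 b + ∑[ a < n ] g (suc a) b)           ∎
  where open ≡-Reasoning

∑-split : ∀ m n (f : ℕ → ℕ) → ∑< (m + n) f ≡ ∑< m f + ∑[ i < n ] f (m + i)
∑-split zero    n f = refl
∑-split (suc m) n f = trans (cong (f 0 +_) (∑-split m n (f ∘ suc))) (sym (+-assoc (f 0) _ _))

∑-last : ∀ n (f : ℕ → ℕ) → ∑< (suc n) f ≡ ∑< n f + f n
∑-last zero    f = +-identityʳ (f 0)
∑-last (suc n) f = trans (cong (f 0 +_) (∑-last n (f ∘ suc))) (sym (+-assoc (f 0) _ _))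

∑-reverse : ∀ n (f : ℕ → ℕ) → ∑[ i < n ] f (n ∸ suc i) ≡ ∑< n f
∑-reverse zero    f = refl
∑-reverse (suc n) f = begin
  f n + ∑[ i < n ] f (n ∸ suc i)  ≡⟨ cong (f n +_) (∑-reverse n f) ⟩
  f n + ∑< n f                    ≡⟨ +-comm (f n) _ ⟩
  ∑< n f + f n                    ≡⟨ ∑-last n f ⟨
  ∑< (suc n) f                    ∎
  where open ≡-Reasoning

∑-*ˡ : ∀ n c (f : ℕ → ℕ) → ∑[ i < n ] (c * f i) ≡ c * ∑< n f
∑-*ˡ zero    c f = sym (*-zeroʳ c)
∑-*ˡ (suc n) c f = trans (cong (c * f 0 +_) (∑-*ˡ n c (f ∘ suc))) (sym (*-distribˡ-+ c (f 0) _))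

∑-*ʳ : ∀ n c (f : ℕ → ℕ) → ∑[ i < n ] (f i * c) ≡ ∑< n f * c
∑-*ʳ zero    c f = refl
∑-*ʳ (suc n) c f = trans (cong (f 0 * c +_) (∑-*ʳ n c (f ∘ suc))) (sym (*-distribʳ-+ c (f 0) _))

𝟙 : Bool → ℕ
𝟙 true  = 1
𝟙 false = 0

𝟙≤1 : ∀ x → 𝟙 x ≤ 1
𝟙≤1 true  = ≤-refl
𝟙≤1 false = z≤n

𝟙-mono : ∀ {x y : Bool} → (x ≡ true → y ≡ true) → 𝟙 x ≤ 𝟙 y
𝟙-mono {false} _   = z≤n
𝟙-mono {true}  x⇒y rewrite x⇒y refl = ≤-refl

𝟙-not : ∀ x → 𝟙 (not x) + 𝟙 x ≡ 1
𝟙-not true  = refl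
𝟙-not false = refl

𝟙-∧ : ∀ x y → 𝟙 (x ∧ y) ≡ 𝟙 x * 𝟙 y
𝟙-∧ true  true  = refl
𝟙-∧ true  false = refl
𝟙-∧ false y     = refl

∧-true⁻ : ∀ {x y : Bool} → x ∧ y ≡ true → x ≡ true × y ≡ true
∧-true⁻ {true} {true} _ = refl , refl

∨-true⁻ : ∀ {x y : Bool} → x ∨ y ≡ true → x ≡ true ⊎ y ≡ true
∨-true⁻ {true}  _   = inj₁ refl
∨-true⁻ {false} y≡t = inj₂ y≡t

∧-false : ∀ x → x ∧ false ≡ false
∧-false true  = refl
∧-false false = refl

<⇒<ᵇ≡true : ∀ {m n} → m < n → (m <ᵇ n) ≡ true
<⇒<ᵇ≡true {m} {n} m<n with m <ᵇ n in eq
... | true  = refl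
... | false = ⊥-elim (subst T eq (<⇒<ᵇ m<n))

<ᵇ≡true⇒< : ∀ {m n} → (m <ᵇ n) ≡ true → m < n
<ᵇ≡true⇒< {m} {n} eq = <ᵇ⇒< m n (subst T (sym eq) tt)

≮⇒<ᵇ≡false : ∀ {m n} → ¬ m < n → (m <ᵇ n) ≡ false
≮⇒<ᵇ≡false {m} {n} m≮n with m <ᵇ n in eq
... | false = refl
... | true  = ⊥-elim (m≮n (<ᵇ≡true⇒< eq))

count-< : ∀ n s → s ≤ n → ∑[ a < n ] 𝟙 (a <ᵇ s) ≡ s
count-< n       zero    _         = ∑-≡0 n (λ _ _ → refl)
count-< (suc n) (suc s) (s≤s s≤n) = cong suc (count-< n s s≤n)

count-≥ : ∀ n d → d ≤ n → ∑[ a < n ] 𝟙 (not (a <ᵇ d)) ≡ n ∸ d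
count-≥ n       zero    _         = trans (∑-const n 1) (*-identityʳ n)
count-≥ (suc n) (suc d) (s≤s d≤n) = count-≥ n d d≤n

any< : ℕ → (ℕ → Bool) → Bool
any< zero    p = false
any< (suc n) p = p 0 ∨ any< n (p ∘ suc)

any<⇒∃ : ∀ n (p : ℕ → Bool) → any< n p ≡ true → ∃ λ i → i < n × p i ≡ true
any<⇒∃ (suc n) p any≡t with p 0 in p0
... | true  = 0 , z<s , p0
... | false with any<⇒∃ n (p ∘ suc) any≡t
...   | i , i<n , pi = suc i , s<s i<n , pi

∃⇒any< : ∀ n (p : ℕ → Bool) i → i < n → p i ≡ true → any< n p ≡ true
∃⇒any< (suc n) p zero    _         pi rewrite pi = refl
∃⇒any< (suc n) p (suc i) (s<s i<n) pi rewrite ∃⇒any< n (p ∘ suc) i i<n pi = ∨-zeroʳ (p 0)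

any<-false⁻ : ∀ n (p : ℕ → Bool) → any< n p ≡ false → ∀ i → i < n → p i ≡ false
any<-false⁻ (suc n) p any≡f i i<n with p 0 in p0
any<-false⁻ (suc n) p any≡f zero    _         | false = p0
any<-false⁻ (suc n) p any≡f (suc i) (s<s i<n) | false = any<-false⁻ n (p ∘ suc) any≡f i i<n

any<-false : ∀ n → any< n (λ _ → false) ≡ false
any<-false zero    = refl
any<-false (suc n) = any<-false n

count-first-≤1 : ∀ n (p : ℕ → Bool) → ∑[ a < n ] 𝟙 (p a ∧ not (any< a p)) ≤ 1
count-first-≤1 zero    p = z≤n
count-first-≤1 (suc n) p with p 0
... | true  = ≤-reflexive (cong suc (∑-≡0 n (λ a _ → cong 𝟙 (∧-false (p (suc a))))))
... | false = count-first-≤1 n (p ∘ suc)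

count-last-≤1 : ∀ n (p : ℕ → Bool) →
  ∑[ b < n ] 𝟙 (p b ∧ not (any< n (λ b′ → (b <ᵇ b′) ∧ p b′))) ≤ 1
count-last-≤1 zero    p = z≤n
count-last-≤1 (suc n) p with any< n (p ∘ suc) in later
... | true  rewrite ∧-false (p 0) = count-last-≤1 n (p ∘ suc)
... | false = ≤-trans (≤-reflexive (trans (cong (𝟙 (p 0 ∧ true) +_) (∑-≡0 n none-later)) (+-identityʳ _)))
                      (𝟙≤1 (p 0 ∧ true))
  where
  none-later : ∀ b → b < n → 𝟙 (p (suc b) ∧ not (any< n (λ b′ → (b <ᵇ b′) ∧ p (suc b′)))) ≡ 0
  none-later b b<n rewrite any<-false⁻ n (p ∘ suc) later b b<n = refl

Matrix : Set
Matrix = ℕ → ℕ → Bool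

ones : ℕ → Matrix → ℕ
ones K e = ∑[ a < K ] ∑[ b < K ] 𝟙 (e a b)

Increasing : ℕ → (ℕ → ℕ) → Set
Increasing k f = ∀ {p q} → p < q → q < k → f p < f q

step-increasing⇒increasing : ∀ k (f : ℕ → ℕ) → (∀ j → suc j < k → f j < f (suc j)) → Increasing k f
step-increasing⇒increasing k f step {p} {suc q} p<1+q 1+q<k with m≤n⇒m<n∨m≡n (s≤s⁻¹ p<1+q)
... | inj₁ p<q  = <-trans (step-increasing⇒increasing k f step p<q (<-trans (n<1+n q) 1+q<k)) (step q 1+q<k)
... | inj₂ refl = step q 1+q<k

record Staircase (e : Matrix) (K k : ℕ) : Set where
  field
    row col   : ℕ → ℕ
    row-<     : ∀ j → suc j < k → row j < row (suc j)
    col-<     : ∀ j → suc j < k → col j < col (suc j)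
    row-bound : ∀ j → j < k → row j < K
    col-bound : ∀ j → j < k → col j < K
    at        : ∀ j → j < k → e (row j) (col j) ≡ true
    below     : ∀ j → suc j < k → e (row (suc j)) (col j) ≡ true

  row-increasing : Increasing k row
  row-increasing = step-increasing⇒increasing k row row-<

  col-increasing : Increasing k col
  col-increasing = step-increasing⇒increasing k col col-<

singleton-staircase : ∀ (e : Matrix) K a b → a < K → b < K → e a b ≡ true → Staircase e K 1
singleton-staircase e K a b a<K b<K eab = record
  { row = λ _ → a ; col = λ _ → b
  ; row-< = λ { _ (s≤s ()) } ; col-< = λ { _ (s≤s ()) }
  ; row-bound = λ _ _ → a<K ; col-bound = λ _ _ → b<K
  ; at = λ _ _ → eab ; below = λ { _ (s≤s ()) } }

staircase-free⇒ones≡0 : ∀ K (e : Matrix) → ¬ Staircase e K 1 → ones K e ≡ 0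
staircase-free⇒ones≡0 K e free = ∑-≡0 K (λ a a<K → ∑-≡0 K (λ b b<K → entry≡0 a b a<K b<K))
  where
  entry≡0 : ∀ a b → a < K → b < K → 𝟙 (e a b) ≡ 0
  entry≡0 a b a<K b<K with e a b in eab
  ... | false = refl
  ... | true  = ⊥-elim (free (singleton-staircase e K a b a<K b<K eab))

module Peeling (e : Matrix) where

  reachable shallow deep : Matrix
  reachable a b = any< a (λ a′ → any< b (λ b′ → e a′ b′ ∧ e a b′))
  shallow   a b = e a b ∧ not (reachable a b)
  deep      a b = reachable a b ∧ e a b

  shifted-deep : Matrix
  shifted-deep a b = deep (suc a) (suc b)

  reachable⇒witness : ∀ {a b} → reachable a b ≡ true →
    ∃₂ λ a′ b′ → a′ < a × b′ < b × e a′ b′ ≡ true × e a b′ ≡ true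
  reachable⇒witness {a} {b} r with any<⇒∃ a _ r
  ... | a′ , a′<a , r′ with any<⇒∃ b _ r′
  ...   | b′ , b′<b , both with ∧-true⁻ both
  ...     | ea′b′ , eab′ = a′ , b′ , a′<a , b′<b , ea′b′ , eab′

  ones-shallow+deep : ∀ K → ones K e ≡ ones K shallow + ones K deep
  ones-shallow+deep K =
    trans (∑-cong K (λ a _ → ∑-cong K (λ b _ → entry a b)))
          (∑∑-distrib-+ K (λ a b → 𝟙 (shallow a b)) (λ a b → 𝟙 (deep a b)))
    where
    entry : ∀ a b → 𝟙 (e a b) ≡ 𝟙 (shallow a b) + 𝟙 (deep a b)
    entry a b with e a b | reachable a b
    ... | true  | true  = refl
    ... | true  | false = refl
    ... | false | true  = refl
    ... | false | false = refl

  ones-deep : ∀ K → ones (suc K) deep ≡ ones K shifted-deep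
  ones-deep K =
    cong₂ _+_ (∑-≡0 (suc K) (λ _ _ → refl))
              (∑-cong K (λ a _ → cong (_+ ∑[ b < K ] 𝟙 (shifted-deep a b)) (first-column a)))
    where
    first-column : ∀ a → 𝟙 (deep (suc a) 0) ≡ 0
    first-column a rewrite any<-false a = refl

  deep-staircase-extends : ∀ K k → Staircase shifted-deep K (suc k) → Staircase e (suc K) (suc (suc k))
  deep-staircase-extends K k st with reachable⇒witness (proj₁ (∧-true⁻ (Staircase.at st 0 z<s)))
  ... | a′ , b′ , a′<a , b′<b , ea′b′ , eab′ = record
    { row = row′ ; col = col′ ; row-< = row-<′ ; col-< = col-<′
    ; row-bound = row-bound′ ; col-bound = col-bound′ ; at = at′ ; below = below′ }
    where
    open Staircase st
    row′ col′ : ℕ → ℕ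
    row′ zero    = a′
    row′ (suc j) = suc (row j)
    col′ zero    = b′
    col′ (suc j) = suc (col j)
    row-<′ : ∀ j → suc j < suc (suc k) → row′ j < row′ (suc j)
    row-<′ zero    _         = a′<a
    row-<′ (suc j) (s<s j<k) = s<s (row-< j j<k)
    col-<′ : ∀ j → suc j < suc (suc k) → col′ j < col′ (suc j)
    col-<′ zero    _         = b′<b
    col-<′ (suc j) (s<s j<k) = s<s (col-< j j<k)
    row-bound′ : ∀ j → j < suc (suc k) → row′ j < suc K
    row-bound′ zero    _         = <-trans a′<a (s<s (row-bound 0 z<s))
    row-bound′ (suc j) (s<s j<k) = s<s (row-bound j j<k)
    col-bound′ : ∀ j → j < suc (suc k) → col′ j < suc K
    col-bound′ zero    _         = <-trans b′<b (s<s (col-bound 0 z<s))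
    col-bound′ (suc j) (s<s j<k) = s<s (col-bound j j<k)
    at′ : ∀ j → j < suc (suc k) → e (row′ j) (col′ j) ≡ true
    at′ zero    _         = ea′b′
    at′ (suc j) (s<s j<k) = proj₂ (∧-true⁻ (at j j<k))
    below′ : ∀ j → suc j < suc (suc k) → e (row′ (suc j)) (col′ j) ≡ true
    below′ zero    _         = eab′
    below′ (suc j) (s<s j<k) = proj₂ (∧-true⁻ (below j j<k))

  above : Matrix
  above a b = any< a (λ a′ → e a′ b)

  firstInColumn : Matrix
  firstInColumn a b = shallow a b ∧ not (above a b)

  lastInRow : ℕ → Matrix
  lastInRow K a b = above a b ∧ (shallow a b ∧ not (any< K (λ b′ → (b <ᵇ b′) ∧ shallow a b′)))

  above⇒reachable-right : ∀ {a b b′} → above a b ≡ true → e a b ≡ true → b < b′ → reachable a b′ ≡ true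
  above⇒reachable-right {a} {b} {b′} ab eab b<b′ with any<⇒∃ a _ ab
  ... | a′ , a′<a , ea′b =
    ∃⇒any< a _ a′ a′<a (∃⇒any< b′ _ b b<b′ (cong₂ _∧_ ea′b eab))

  shallow-right-of-above : ∀ {a b b′} → above a b ≡ true → shallow a b ≡ true → b < b′ →
                           shallow a b′ ≡ false
  shallow-right-of-above {a} {b′ = b′} ab sh b<b′
    rewrite above⇒reachable-right ab (proj₁ (∧-true⁻ sh)) b<b′ = ∧-false (e a b′)

  -- A shallow one with a one above it is the last shallow one of its row: every cell to its
  -- right is reachable through it.
  shallow≤first+last : ∀ K a b → 𝟙 (shallow a b) ≤ 𝟙 (firstInColumn a b) + 𝟙 (lastInRow K a b)
  shallow≤first+last K a b with shallow a b in sh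
  ... | false = z≤n
  ... | true with above a b in ab
  ...   | false = s≤s z≤n
  ...   | true with any< K (λ b′ → (b <ᵇ b′) ∧ shallow a b′) in later
  ...     | false = s≤s z≤n
  ...     | true with any<⇒∃ K _ later
  ...       | b′ , _ , b<b′∧sh′ with ∧-true⁻ {b <ᵇ b′} b<b′∧sh′
  ...         | b<b′ , sh′ with trans (sym sh′) (shallow-right-of-above ab sh (<ᵇ≡true⇒< b<b′))
  ...           | ()

  ones-firstInColumn-≤ : ∀ n → ones n firstInColumn ≤ n
  ones-firstInColumn-≤ n = begin
    ones n firstInColumn                        ≡⟨ ∑-comm n n (λ a b → 𝟙 (firstInColumn a b)) ⟩
    ∑[ b < n ] ∑[ a < n ] 𝟙 (firstInColumn a b) ≤⟨ ∑-≤-length n (λ b _ → column b) ⟩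
    n                                           ∎
    where
    open ≤-Reasoning
    first⇒ : ∀ a b → firstInColumn a b ≡ true → e a b ∧ not (above a b) ≡ true
    first⇒ a b h with ∧-true⁻ {shallow a b} h
    ... | sh , not-above = cong₂ _∧_ (proj₁ (∧-true⁻ sh)) not-above
    column : ∀ b → ∑[ a < n ] 𝟙 (firstInColumn a b) ≤ 1
    column b = ≤-trans (∑-mono-≤ n (λ a _ → 𝟙-mono (first⇒ a b))) (count-first-≤1 n (λ a → e a b))

  ones-lastInRow-≤ : ∀ K → ones (suc K) (lastInRow (suc K)) ≤ K
  ones-lastInRow-≤ K = begin
    ones (suc K) (lastInRow (suc K))
      ≡⟨ cong (_+ ∑[ a < K ] ∑[ b < suc K ] 𝟙 (lastInRow (suc K) (suc a) b)) (∑-≡0 (suc K) (λ _ _ → refl)) ⟩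
    ∑[ a < K ] ∑[ b < suc K ] 𝟙 (lastInRow (suc K) (suc a) b)
      ≤⟨ ∑-≤-length K (λ a _ → row (suc a)) ⟩
    K ∎
    where
    open ≤-Reasoning
    last⇒ : ∀ a b → lastInRow (suc K) a b ≡ true →
            shallow a b ∧ not (any< (suc K) (λ b′ → (b <ᵇ b′) ∧ shallow a b′)) ≡ true
    last⇒ a b = proj₂ ∘ ∧-true⁻ {above a b}
    row : ∀ a → ∑[ b < suc K ] 𝟙 (lastInRow (suc K) a b) ≤ 1
    row a = ≤-trans (∑-mono-≤ (suc K) (λ b _ → 𝟙-mono (last⇒ a b))) (count-last-≤1 (suc K) (shallow a))

  ones-shallow-≤ : ∀ K → ones (suc K) shallow ≤ suc (K + K)
  ones-shallow-≤ K = begin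
    ones (suc K) shallow
      ≤⟨ ∑-mono-≤ (suc K) (λ a _ → ∑-mono-≤ (suc K) (λ b _ → shallow≤first+last (suc K) a b)) ⟩
    ∑[ a < suc K ] ∑[ b < suc K ] (𝟙 (firstInColumn a b) + 𝟙 (lastInRow (suc K) a b))
      ≡⟨ ∑∑-distrib-+ (suc K) (λ a b → 𝟙 (firstInColumn a b)) (λ a b → 𝟙 (lastInRow (suc K) a b)) ⟩
    ones (suc K) firstInColumn + ones (suc K) (lastInRow (suc K))
      ≤⟨ +-mono-≤ (ones-firstInColumn-≤ (suc K)) (ones-lastInRow-≤ K) ⟩
    suc (K + K) ∎
    where open ≤-Reasoning

staircase-bound-step : ∀ k s → suc ((k + s) + (k + s)) + k * (k + 2 * s) ≡ suc k * (suc k + 2 * s)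
staircase-bound-step = solve-∀

staircase-free⇒ones-≤ : ∀ k s (e : Matrix) → ¬ Staircase e (k + s) (suc k) → ones (k + s) e ≤ k * (k + 2 * s)
staircase-free⇒ones-≤ zero    s e free = ≤-reflexive (staircase-free⇒ones≡0 s e free)
staircase-free⇒ones-≤ (suc k) s e free = begin
  ones (suc K) e                                  ≡⟨ ones-shallow+deep (suc K) ⟩
  ones (suc K) shallow + ones (suc K) deep        ≡⟨ cong (ones (suc K) shallow +_) (ones-deep K) ⟩
  ones (suc K) shallow + ones K shifted-deep
    ≤⟨ +-mono-≤ (ones-shallow-≤ K)
                (staircase-free⇒ones-≤ k s shifted-deep (free ∘ deep-staircase-extends K k)) ⟩
  suc (K + K) + k * (k + 2 * s)                   ≡⟨ staircase-bound-step k s ⟩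
  suc k * (suc k + 2 * s)                         ∎
  where
  K : ℕ
  K = k + s
  open ≤-Reasoning
  open Peeling e

2*n≡n+n : ∀ n → 2 * n ≡ n + n
2*n≡n+n n = cong (n +_) (+-identityʳ n)

sum-map-allFin : ∀ m (g : Fin m → ℕ) (h : ℕ → ℕ) → (∀ x → g x ≡ h (toℕ x)) →
                 sum (map g (allFin m)) ≡ ∑< m h
sum-map-allFin m g h g≡h = trans (cong sum (map-tabulate (λ x → x) g)) (sum-tabulate m g h g≡h)
  where
  sum-tabulate : ∀ m (g : Fin m → ℕ) (h : ℕ → ℕ) → (∀ x → g x ≡ h (toℕ x)) →
                 sum (tabulate g) ≡ ∑< m h
  sum-tabulate zero    g h g≡h = refl
  sum-tabulate (suc m) g h g≡h = cong₂ _+_ (g≡h fzero) (sum-tabulate m (g ∘ fsuc) (h ∘ suc) (g≡h ∘ fsuc))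

-- false whenever an index is out of range
adjℕ : ∀ {m} → OrderedGraph m → Matrix
adjℕ {m} G i j with i <? m | j <? m
... | yes i<m | yes j<m = adj G (fromℕ< i<m) (fromℕ< j<m)
... | _       | _       = false

module _ {m : ℕ} (G : OrderedGraph m) where

  adjℕ-toℕ : ∀ x y → adjℕ G (toℕ x) (toℕ y) ≡ adj G x y
  adjℕ-toℕ x y with toℕ x <? m | toℕ y <? m
  ... | yes x<m | yes y<m = cong₂ (adj G) (fromℕ<-toℕ x x<m) (fromℕ<-toℕ y y<m)
  ... | no  x≮m | _       = ⊥-elim (x≮m (toℕ<n x))
  ... | yes _   | no  y≮m = ⊥-elim (y≮m (toℕ<n y))

  adjℕ-sym : ∀ i j → adjℕ G i j ≡ adjℕ G j i
  adjℕ-sym i j with i <? m | j <? m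
  ... | yes i<m | yes j<m = OrderedGraph.sym G (fromℕ< i<m) (fromℕ< j<m)
  ... | yes _   | no  _   = refl
  ... | no  _   | yes _   = refl
  ... | no  _   | no  _   = refl

  adjℕ-true⁻ : ∀ i j → adjℕ G i j ≡ true →
               Σ (i < m) λ i<m → Σ (j < m) λ j<m → adj G (fromℕ< i<m) (fromℕ< j<m) ≡ true
  adjℕ-true⁻ i j ij with i <? m | j <? m
  ... | yes i<m | yes j<m = i<m , j<m , ij

  edgeCount≡∑ : edgeCount G ≡ ∑[ i < m ] ∑[ j < m ] 𝟙 ((i <ᵇ j) ∧ adjℕ G i j)
  edgeCount≡∑ = sum-map-allFin m _ _ (λ x → sum-map-allFin m _ _ (λ y → entry (toℕ x <ᵇ toℕ y) x y))
    where
    entry : ∀ b x y → (if b ∧ adj G x y then 1 else 0) ≡ 𝟙 (b ∧ adjℕ G (toℕ x) (toℕ y))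
    entry b x y rewrite adjℕ-toℕ x y with b ∧ adj G x y
    ... | true  = refl
    ... | false = refl

biadjacency : (K : ℕ) → OrderedGraph (2 * K) → Matrix
biadjacency K G a b = adjℕ G a (K + b)

module _ (K : ℕ) (G : OrderedGraph (2 * K)) (bipartite : BipartiteSplit K G) where

  adjℕ-bipartite : ∀ i j → adjℕ G i j ≡ true → (i < K × K ≤ j) ⊎ (j < K × K ≤ i)
  adjℕ-bipartite i j ij with adjℕ-true⁻ G i j ij
  ... | i<2K , j<2K , e =
    subst₂ (λ u v → (u < K × K ≤ v) ⊎ (v < K × K ≤ u))
           (toℕ-fromℕ< i<2K) (toℕ-fromℕ< j<2K) (bipartite _ _ e)

  edgeCount-bipartite : edgeCount G ≡ ones K (biadjacency K G)
  edgeCount-bipartite = begin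
    edgeCount G                             ≡⟨ edgeCount≡∑ G ⟩
    ∑< (2 * K) rowSum                       ≡⟨ cong (λ n → ∑< n rowSum) (2*n≡n+n K) ⟩
    ∑< (K + K) rowSum                       ≡⟨ ∑-split K K rowSum ⟩
    ∑< K rowSum + ∑[ i < K ] rowSum (K + i) ≡⟨ cong₂ _+_ (∑-cong K left-row) (∑-≡0 K (λ i _ → right-row i)) ⟩
    ones K (biadjacency K G) + 0            ≡⟨ +-identityʳ _ ⟩
    ones K (biadjacency K G)                ∎
    where
    open ≡-Reasoning
    rowSum : ℕ → ℕ
    rowSum i = ∑[ j < 2 * K ] 𝟙 ((i <ᵇ j) ∧ adjℕ G i j)
    -- An edge is counted at its smaller endpoint, which lies in the left part.
    right-entry : ∀ i j → 𝟙 ((K + i <ᵇ j) ∧ adjℕ G (K + i) j) ≡ 0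
    right-entry i j with adjℕ G (K + i) j in e
    ... | false = cong 𝟙 (∧-false _)
    ... | true with adjℕ-bipartite (K + i) j e
    ...   | inj₁ (K+i<K , _) = ⊥-elim (m+n≮m K i K+i<K)
    ...   | inj₂ (j<K , _) rewrite ≮⇒<ᵇ≡false (λ K+i<j → m+n≮m K i (<-trans K+i<j j<K)) = refl
    right-row : ∀ i → rowSum (K + i) ≡ 0
    right-row i = ∑-≡0 (2 * K) (λ j _ → right-entry i j)
    left-left-entry : ∀ i j → i < K → j < K → 𝟙 ((i <ᵇ j) ∧ adjℕ G i j) ≡ 0
    left-left-entry i j i<K j<K with adjℕ G i j in e
    ... | false = cong 𝟙 (∧-false _)
    ... | true with adjℕ-bipartite i j e
    ...   | inj₁ (_ , K≤j) = ⊥-elim (<⇒≱ j<K K≤j)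
    ...   | inj₂ (_ , K≤i) = ⊥-elim (<⇒≱ i<K K≤i)
    left-row : ∀ i → i < K → rowSum i ≡ ∑[ b < K ] 𝟙 (biadjacency K G i b)
    left-row i i<K = begin
      rowSum i
        ≡⟨ cong (λ n → ∑[ j < n ] 𝟙 ((i <ᵇ j) ∧ adjℕ G i j)) (2*n≡n+n K) ⟩
      ∑[ j < K + K ] 𝟙 ((i <ᵇ j) ∧ adjℕ G i j)
        ≡⟨ ∑-split K K _ ⟩
      ∑[ j < K ] 𝟙 ((i <ᵇ j) ∧ adjℕ G i j) + ∑[ b < K ] 𝟙 ((i <ᵇ K + b) ∧ adjℕ G i (K + b))
        ≡⟨ cong₂ _+_ (∑-≡0 K (λ j j<K → left-left-entry i j i<K j<K))
                     (∑-cong K (λ b _ → cong (λ x → 𝟙 (x ∧ adjℕ G i (K + b)))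
                                              (<⇒<ᵇ≡true (<-≤-trans i<K (m≤m+n K b))))) ⟩
      ∑[ b < K ] 𝟙 (biadjacency K G i b) ∎

n∸1+m<n : ∀ {m n} → m < n → n ∸ suc m < n
n∸1+m<n m<n = ∸-monoʳ-< z<s m<n

1+[n∸1+m]≡n∸m : ∀ {m n} → m < n → suc (n ∸ suc m) ≡ n ∸ m
1+[n∸1+m]≡n∸m {zero}  {suc n} _         = refl
1+[n∸1+m]≡n∸m {suc m} {suc n} (s<s m<n) = 1+[n∸1+m]≡n∸m m<n

-- Copies of P_{2k}^t become staircases: P^{>,>} read backwards is P^{<,<} with the
-- two halves exchanged, and P^{<,>}, P^{>,<} reverse the order of one half.
orient : PathType → ℕ → Matrix → Matrix
orient ll K e a b = e a b
orient gg K e a b = e b a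
orient lg K e a b = e a (K ∸ suc b)
orient gl K e a b = e (K ∸ suc a) b

ones-orient : ∀ t K e → ones K (orient t K e) ≡ ones K e
ones-orient ll K e = refl
ones-orient gg K e = ∑-comm K K (λ a b → 𝟙 (e b a))
ones-orient lg K e = ∑-cong K (λ a _ → ∑-reverse K (λ b → 𝟙 (e a b)))
ones-orient gl K e = ∑-reverse K (λ a → ∑[ b < K ] 𝟙 (e a b))

-- Linked t k p m: in P_{2k}^t the vertices p + 1 and k + m + 1 are adjacent (p, m < k).
Linked : PathType → ℕ → ℕ → ℕ → Set
Linked ll k p m = m ≡ p ⊎ p ≡ suc m
Linked gg k p m = m ≡ p ⊎ m ≡ suc p
Linked lg k p m = suc (p + m) ≡ k ⊎ p + m ≡ k
Linked gl k p m = suc (m + p) ≡ k ⊎ suc (suc (m + p)) ≡ k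

-- v_{2i+1} = leftIndex t k i + 1 and v_{2i+2} = k + rightIndex t k i + 1.
leftIndex rightIndex : PathType → ℕ → ℕ → ℕ
leftIndex ll k i = i
leftIndex gg k i = k ∸ suc i
leftIndex lg k i = i
leftIndex gl k i = k ∸ suc i
rightIndex ll k i = i
rightIndex gg k i = k ∸ suc i
rightIndex lg k i = k ∸ suc i
rightIndex gl k i = i

leftIndex<k : ∀ t {k i} → i < k → leftIndex t k i < k
leftIndex<k ll i<k = i<k
leftIndex<k gg i<k = n∸1+m<n i<k
leftIndex<k lg i<k = i<k
leftIndex<k gl i<k = n∸1+m<n i<k

rightIndex<k : ∀ t {k i} → i < k → rightIndex t k i < k
rightIndex<k ll i<k = i<k
rightIndex<k gg i<k = n∸1+m<n i<k
rightIndex<k lg i<k = n∸1+m<n i<k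
rightIndex<k gl i<k = i<k

oddV≡leftIndex : ∀ t {k i} → i < k → oddV t k (suc i) ≡ leftIndex t k i + 1
oddV≡leftIndex ll {i = i} _   = +-comm 1 i
oddV≡leftIndex gg         i<k = +-∸-comm 1 i<k
oddV≡leftIndex lg {i = i} _   = +-comm 1 i
oddV≡leftIndex gl         i<k = +-∸-comm 1 i<k

evenV≡k+rightIndex : ∀ t {k i} → i < k → evenV t k (suc i) ≡ k + rightIndex t k i + 1
evenV≡k+rightIndex ll {k} {i} _ = trans (+-suc k i) (+-comm 1 (k + i))
evenV≡k+rightIndex gg i<k = reversed-right i<k
  where
  reversed-right : ∀ {k i} → i < k → 2 * k + 1 ∸ suc i ≡ k + (k ∸ suc i) + 1
  reversed-right {k} {i} i<k = begin
    2 * k + 1 ∸ suc i       ≡⟨ +-∸-comm 1 (≤-trans i<k (m≤m+n k (k + 0))) ⟩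
    2 * k ∸ suc i + 1       ≡⟨ cong (_+ 1) (+-∸-assoc k (≤-trans i<k (≤-reflexive (sym (+-identityʳ k))))) ⟩
    k + (k + 0 ∸ suc i) + 1 ≡⟨ cong (λ n → k + (n ∸ suc i) + 1) (+-identityʳ k) ⟩
    k + (k ∸ suc i) + 1     ∎
    where open ≡-Reasoning
evenV≡k+rightIndex lg i<k = evenV≡k+rightIndex gg i<k
evenV≡k+rightIndex gl i<k = evenV≡k+rightIndex ll i<k

linked-odd : ∀ t {k i} → i < k → Linked t k (leftIndex t k i) (rightIndex t k i)
linked-odd ll _ = inj₁ refl
linked-odd gg _ = inj₁ refl
linked-odd lg i<k = inj₁ (m+[n∸m]≡n i<k)
linked-odd gl i<k = inj₁ (m+[n∸m]≡n i<k)

linked-even : ∀ t {k i} → suc i < k → Linked t k (leftIndex t k (suc i)) (rightIndex t k i)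
linked-even ll _ = inj₂ refl
linked-even gg si<k = inj₂ (sym (1+[n∸1+m]≡n∸m si<k))
linked-even lg si<k = inj₂ (m+[n∸m]≡n (<⇒≤ si<k))
linked-even gl si<k = inj₂ (m+[n∸m]≡n si<k)

SamePair-pred : ∀ {a b c d c′ d′} → c′ ≡ c + 1 → d′ ≡ d + 1 →
                SamePair (a + 1) (b + 1) c′ d′ → SamePair a b c d
SamePair-pred c′≡ d′≡ (inj₁ (a≡ , b≡)) = inj₁ (+-cancelʳ-≡ 1 _ _ (trans a≡ c′≡) , +-cancelʳ-≡ 1 _ _ (trans b≡ d′≡))
SamePair-pred c′≡ d′≡ (inj₂ (a≡ , b≡)) = inj₂ (+-cancelʳ-≡ 1 _ _ (trans a≡ d′≡) , +-cancelʳ-≡ 1 _ _ (trans b≡ c′≡))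

LinkedEdge : PathType → ℕ → ℕ → ℕ → Set
LinkedEdge t k x y = ∃₂ λ p m → p < k × m < k × Linked t k p m × SamePair x y p (k + m)

pathEdge⇒linkedEdge : ∀ t k x y → PathEdgeℕ t k (x + 1) (y + 1) → LinkedEdge t k x y
pathEdge⇒linkedEdge t k x y (suc i , _ , inj₁ (i<k , same)) =
  leftIndex t k i , rightIndex t k i , leftIndex<k t i<k , rightIndex<k t i<k , linked-odd t i<k ,
  SamePair-pred (oddV≡leftIndex t i<k) (evenV≡k+rightIndex t i<k) same
pathEdge⇒linkedEdge t k x y (suc i , _ , inj₂ (1+i+1≤k , same)) =
  leftIndex t k (suc i) , rightIndex t k i , leftIndex<k t 1+i<k , rightIndex<k t (<-trans (n<1+n i) 1+i<k) ,
  linked-even t 1+i<k ,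
  swap (SamePair-pred (evenV≡k+rightIndex t (<-trans (n<1+n i) 1+i<k))
                      (trans (cong (oddV t k) (+-comm (suc i) 1)) (oddV≡leftIndex t 1+i<k)) same)
  where
  1+i<k : suc i < k
  1+i<k = subst (_≤ k) (+-comm (suc i) 1) 1+i+1≤k

reverse-increasing : ∀ k K (f : ℕ → ℕ) → Increasing k f → (∀ p → p < k → f p < K) →
  Increasing k (λ p → K ∸ suc (f (k ∸ suc p)))
reverse-increasing k K f f-inc f-bound {p} {q} p<q q<k =
  ∸-monoʳ-< (s<s (f-inc (∸-monoʳ-< (s<s p<q) q<k) (n∸1+m<n (<-trans p<q q<k))))
            (f-bound (k ∸ suc p) (n∸1+m<n (<-trans p<q q<k)))

reverse-bound : ∀ k K (f : ℕ → ℕ) → (∀ p → p < k → f p < K) →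
                ∀ p → p < k → K ∸ suc (f (k ∸ suc p)) < K
reverse-bound k K f f-bound p p<k = n∸1+m<n (f-bound (k ∸ suc p) (n∸1+m<n p<k))

module _ (K : ℕ) (G : OrderedGraph (2 * K)) (t : PathType) (k : ℕ) (ρ κ : ℕ → ℕ)
         (ρ-increasing : Increasing k ρ) (κ-increasing : Increasing k κ)
         (ρ-bound : ∀ p → p < k → ρ p < K) (κ-bound : ∀ m → m < k → κ m < K)
         (linked⇒adj : ∀ p m → p < k → m < k → Linked t k p m → adjℕ G (ρ p) (K + κ m) ≡ true) where

  private
    embedℕ : ℕ → ℕ
    embedℕ p = if p <ᵇ k then ρ p else K + κ (p ∸ k)

    embedℕ-left : ∀ p → p < k → embedℕ p ≡ ρ p
    embedℕ-left p p<k rewrite <⇒<ᵇ≡true p<k = refl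

    embedℕ-right : ∀ m → embedℕ (k + m) ≡ K + κ m
    embedℕ-right m rewrite ≮⇒<ᵇ≡false (m+n≮m k m) | m+n∸m≡n k m = refl

    data Half (p : ℕ) : Set where
      left  : p < k → Half p
      right : ∀ m → p ≡ k + m → Half p

    half : ∀ p → Half p
    half p with p <? k
    ... | yes p<k = left p<k
    ... | no  p≮k = right (p ∸ k) (sym (m+[n∸m]≡n (≮⇒≥ p≮k)))

    k+m<2k⇒m<k : ∀ {m} → k + m < 2 * k → m < k
    k+m<2k⇒m<k {m} k+m<2k = +-cancelˡ-< k m k (subst (k + m <_) (2*n≡n+n k) k+m<2k)

    embedℕ-bound : ∀ p → p < 2 * k → embedℕ p < 2 * K
    embedℕ-bound p p<2k = subst (embedℕ p <_) (sym (2*n≡n+n K)) (within-halves (half p) p<2k)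
      where
      within-halves : ∀ {p} → Half p → p < 2 * k → embedℕ p < K + K
      within-halves {p} (left p<k) _ rewrite embedℕ-left p p<k = ≤-trans (ρ-bound p p<k) (m≤m+n K K)
      within-halves (right m refl) k+m<2k rewrite embedℕ-right m = +-monoʳ-< K (κ-bound m (k+m<2k⇒m<k k+m<2k))

    embedℕ-increasing : Increasing (2 * k) embedℕ
    embedℕ-increasing {p} {q} p<q q<2k with half p | half q
    ... | left p<k | left q<k rewrite embedℕ-left p p<k | embedℕ-left q q<k = ρ-increasing p<q q<k
    ... | left p<k | right m refl rewrite embedℕ-left p p<k | embedℕ-right m = ≤-trans (ρ-bound p p<k) (m≤m+n K (κ m))
    ... | right m refl | left q<k = ⊥-elim (m+n≮m k m (<-trans p<q q<k))
    ... | right m refl | right m′ refl rewrite embedℕ-right m | embedℕ-right m′ =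
      +-monoʳ-< K (κ-increasing (+-cancelˡ-< k m m′ p<q) (k+m<2k⇒m<k q<2k))

    embed : Fin (2 * k) → Fin (2 * K)
    embed x = fromℕ< (embedℕ-bound (toℕ x) (toℕ<n x))

    toℕ-embed : ∀ x → toℕ (embed x) ≡ embedℕ (toℕ x)
    toℕ-embed x = toℕ-fromℕ< (embedℕ-bound (toℕ x) (toℕ<n x))

    linkedEdge⇒adjℕ : ∀ {x y} → LinkedEdge t k x y → adjℕ G (embedℕ x) (embedℕ y) ≡ true
    linkedEdge⇒adjℕ (p , m , p<k , m<k , linked , inj₁ (refl , refl))
      rewrite embedℕ-left p p<k | embedℕ-right m = linked⇒adj p m p<k m<k linked
    linkedEdge⇒adjℕ (p , m , p<k , m<k , linked , inj₂ (refl , refl))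
      rewrite embedℕ-left p p<k | embedℕ-right m = trans (adjℕ-sym G _ _) (linked⇒adj p m p<k m<k linked)

  linked-maps⇒contains : ContainsPath G t k
  linked-maps⇒contains = embed , order-preserving , edge-preserving
    where
    order-preserving : ∀ a b → toℕ a < toℕ b → toℕ (embed a) < toℕ (embed b)
    order-preserving a b a<b rewrite toℕ-embed a | toℕ-embed b = embedℕ-increasing a<b (toℕ<n b)
    edge-preserving : ∀ a b → PathEdge t k a b → adj G (embed a) (embed b) ≡ true
    edge-preserving a b e = begin
      adj G (embed a) (embed b)                 ≡⟨ adjℕ-toℕ G (embed a) (embed b) ⟨
      adjℕ G (toℕ (embed a)) (toℕ (embed b))   ≡⟨ cong₂ (adjℕ G) (toℕ-embed a) (toℕ-embed b) ⟩
      adjℕ G (embedℕ (toℕ a)) (embedℕ (toℕ b))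
        ≡⟨ linkedEdge⇒adjℕ (pathEdge⇒linkedEdge t k (toℕ a) (toℕ b) e) ⟩
      true                                      ∎
      where open ≡-Reasoning

k∸1+m≡p : ∀ {k p m} → suc (p + m) ≡ k → k ∸ suc m ≡ p
k∸1+m≡p {p = p} {m} refl = m+n∸n≡m p m

staircase⇒contains : ∀ K (G : OrderedGraph (2 * K)) t k →
                     Staircase (orient t K (biadjacency K G)) K k → ContainsPath G t k
staircase⇒contains K G ll k st =
  linked-maps⇒contains K G ll k row col row-increasing col-increasing row-bound col-bound linked⇒adj
  where
  open Staircase st
  linked⇒adj : ∀ p m → p < k → m < k → Linked ll k p m → adjℕ G (row p) (K + col m) ≡ true
  linked⇒adj p .p       p<k _ (inj₁ refl) = at p p<k
  linked⇒adj .(suc m) m p<k _ (inj₂ refl) = below m p<k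
staircase⇒contains K G gg k st =
  linked-maps⇒contains K G gg k col row col-increasing row-increasing col-bound row-bound linked⇒adj
  where
  open Staircase st
  linked⇒adj : ∀ p m → p < k → m < k → Linked gg k p m → adjℕ G (col p) (K + row m) ≡ true
  linked⇒adj p .p       p<k _   (inj₁ refl) = at p p<k
  linked⇒adj p .(suc p) _   m<k (inj₂ refl) = below p m<k
staircase⇒contains K G lg k st =
  linked-maps⇒contains K G lg k row col′ row-increasing (reverse-increasing k K col col-increasing col-bound)
                       row-bound (reverse-bound k K col col-bound) linked⇒adj
  where
  open Staircase st
  col′ : ℕ → ℕ
  col′ m = K ∸ suc (col (k ∸ suc m))
  reflected : ∀ {p m i} → k ∸ suc m ≡ i → adjℕ G (row p) (K + (K ∸ suc (col i))) ≡ true →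
              adjℕ G (row p) (K + col′ m) ≡ true
  reflected {p} k∸1+m≡i = subst (λ i → adjℕ G (row p) (K + (K ∸ suc (col i))) ≡ true) (sym k∸1+m≡i)
  linked⇒adj : ∀ p m → p < k → m < k → Linked lg k p m → adjℕ G (row p) (K + col′ m) ≡ true
  linked⇒adj p       m p<k _   (inj₁ e)    = reflected (k∸1+m≡p e) (at p p<k)
  linked⇒adj zero    m _   m<k (inj₂ refl) = ⊥-elim (<-irrefl refl m<k)
  linked⇒adj (suc p) m p<k _   (inj₂ e)    = reflected (k∸1+m≡p e) (below p p<k)
staircase⇒contains K G gl k st =
  linked-maps⇒contains K G gl k row′ col (reverse-increasing k K row row-increasing row-bound)
                       col-increasing (reverse-bound k K row row-bound) col-bound linked⇒adj
  where
  open Staircase st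
  row′ : ℕ → ℕ
  row′ p = K ∸ suc (row (k ∸ suc p))
  reflected : ∀ {p m i} → k ∸ suc p ≡ i → adjℕ G (K ∸ suc (row i)) (K + col m) ≡ true →
              adjℕ G (row′ p) (K + col m) ≡ true
  reflected {m = m} k∸1+p≡i = subst (λ i → adjℕ G (K ∸ suc (row i)) (K + col m) ≡ true) (sym k∸1+p≡i)
  linked⇒adj : ∀ p m → p < k → m < k → Linked gl k p m → adjℕ G (row′ p) (K + col m) ≡ true
  linked⇒adj p m _ m<k (inj₁ e) = reflected (k∸1+m≡p e) (at m m<k)
  linked⇒adj p m _ _   (inj₂ e) = reflected (k∸1+m≡p e) (below m (subst (suc m <_) e (s<s (s<s (m≤m+n m p)))))

avoids⇒edgeCount-≤ : ∀ d s t (G : OrderedGraph (2 * (d + s))) → BipartiteSplit (d + s) G → AvoidsPath G t (suc d) →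
  edgeCount G ≤ d * (d + 2 * s)
avoids⇒edgeCount-≤ d s t G bipartite avoids = begin
  edgeCount G            ≡⟨ edgeCount-bipartite (d + s) G bipartite ⟩
  ones (d + s) E         ≡⟨ ones-orient t (d + s) E ⟨
  ones (d + s) (orient t (d + s) E)
    ≤⟨ staircase-free⇒ones-≤ d s (orient t (d + s) E) (avoids ∘ staircase⇒contains (d + s) G t (suc d)) ⟩
  d * (d + 2 * s)        ∎
  where
  open ≤-Reasoning
  E : Matrix
  E = biadjacency (d + s) G

ones-not-rectangle : ∀ K (R C : ℕ → Bool) →
  ones K (λ a b → not (R a ∧ C b)) + ∑[ a < K ] 𝟙 (R a) * ∑[ b < K ] 𝟙 (C b) ≡ K * K
ones-not-rectangle K R C = begin
  ones K (λ a b → not (R a ∧ C b)) + ∑[ a < K ] 𝟙 (R a) * ∑[ b < K ] 𝟙 (C b)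
    ≡⟨ cong (ones K (λ a b → not (R a ∧ C b)) +_) rectangle ⟨
  ones K (λ a b → not (R a ∧ C b)) + ones K (λ a b → R a ∧ C b)
    ≡⟨ ∑∑-distrib-+ K (λ a b → 𝟙 (not (R a ∧ C b))) (λ a b → 𝟙 (R a ∧ C b)) ⟨
  ∑[ a < K ] ∑[ b < K ] (𝟙 (not (R a ∧ C b)) + 𝟙 (R a ∧ C b))
    ≡⟨ ∑-cong K (λ a _ → ∑-cong K (λ b _ → 𝟙-not (R a ∧ C b))) ⟩
  ∑[ a < K ] ∑[ b < K ] 1
    ≡⟨ ∑-cong K (λ a _ → trans (∑-const K 1) (*-identityʳ K)) ⟩
  ∑[ a < K ] K
    ≡⟨ ∑-const K K ⟩
  K * K ∎
  where
  open ≡-Reasoning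
  rectangle : ones K (λ a b → R a ∧ C b) ≡ ∑[ a < K ] 𝟙 (R a) * ∑[ b < K ] 𝟙 (C b)
  rectangle = begin
    ones K (λ a b → R a ∧ C b)
      ≡⟨ ∑-cong K (λ a _ → ∑-cong K (λ b _ → 𝟙-∧ (R a) (C b))) ⟩
    ∑[ a < K ] ∑[ b < K ] (𝟙 (R a) * 𝟙 (C b))
      ≡⟨ ∑-cong K (λ a _ → ∑-*ˡ K (𝟙 (R a)) (λ b → 𝟙 (C b))) ⟩
    ∑[ a < K ] (𝟙 (R a) * ∑[ b < K ] 𝟙 (C b))
      ≡⟨ ∑-*ʳ K (∑[ b < K ] 𝟙 (C b)) (λ a → 𝟙 (R a)) ⟩
    ∑[ a < K ] 𝟙 (R a) * ∑[ b < K ] 𝟙 (C b)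
      ∎

increasing⇒spread : ∀ n (f : ℕ → ℕ) → Increasing n f → ∀ p r → p + r < n → f p + r ≤ f (p + r)
increasing⇒spread n f f-inc p zero    _       rewrite +-identityʳ p | +-identityʳ (f p) = ≤-refl
increasing⇒spread n f f-inc p (suc r) p+1+r<n rewrite +-suc (f p) r =
  ≤-trans (s≤s (increasing⇒spread n f f-inc p r (<-trans p+r<p+1+r p+1+r<n))) (f-inc p+r<p+1+r p+1+r<n)
  where
  p+r<p+1+r : p + r < p + suc r
  p+r<p+1+r = +-monoʳ-< p (n<1+n r)

module _ {n N : ℕ} (F : Fin n → Fin N) where

  extendℕ : ℕ → ℕ
  extendℕ p with p <? n
  ... | yes p<n = toℕ (F (fromℕ< p<n))
  ... | no  _   = 0

  extendℕ-fromℕ< : ∀ p (p<n : p < n) → extendℕ p ≡ toℕ (F (fromℕ< p<n))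
  extendℕ-fromℕ< p p<n with p <? n
  ... | yes _   = refl
  ... | no  p≮n = ⊥-elim (p≮n p<n)

  extendℕ-bound : ∀ p → p < n → extendℕ p < N
  extendℕ-bound p p<n rewrite extendℕ-fromℕ< p p<n = toℕ<n _

  extendℕ-increasing : (∀ a b → toℕ a < toℕ b → toℕ (F a) < toℕ (F b)) → Increasing n extendℕ
  extendℕ-increasing F-increasing {p} {q} p<q q<n
    rewrite extendℕ-fromℕ< p (<-trans p<q q<n) | extendℕ-fromℕ< q q<n =
    F-increasing _ _ (subst₂ _<_ (sym (toℕ-fromℕ< (<-trans p<q q<n))) (sym (toℕ-fromℕ< q<n)) p<q)

odd-pathEdge : ∀ t {k i} → i < k → PathEdgeℕ t k (leftIndex t k i + 1) (k + rightIndex t k i + 1)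
odd-pathEdge t {i = i} i<k =
  suc i , s≤s z≤n , inj₁ (i<k , inj₁ (sym (oddV≡leftIndex t i<k) , sym (evenV≡k+rightIndex t i<k)))

module Cornerless (d s : ℕ) where

  K : ℕ
  K = d + s

  initial final : ℕ → Bool
  initial a = a <ᵇ s
  final   a = not (a <ᵇ d)

  cornerRow cornerCol : PathType → ℕ → Bool
  cornerRow ll = initial
  cornerRow gg = final
  cornerRow lg = initial
  cornerRow gl = final
  cornerCol ll = initial
  cornerCol gg = final
  cornerCol lg = final
  cornerCol gl = initial

  corner : PathType → Matrix
  corner t a b = cornerRow t a ∧ cornerCol t b

  crossing : PathType → ℕ → ℕ → Bool
  crossing t i j = (i <ᵇ K) ∧ (not (j <ᵇ K) ∧ not (corner t i (j ∸ K)))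

  crossing-irrefl : ∀ t i → crossing t i i ≡ false
  crossing-irrefl t i with i <ᵇ K
  ... | false = refl
  ... | true  = refl

  crossing⇒ : ∀ t i j → crossing t i j ≡ true → i < K × K ≤ j × corner t i (j ∸ K) ≡ false
  crossing⇒ t i j c with i <ᵇ K in i<K | j <ᵇ K in j<K | corner t i (j ∸ K) | c
  ... | true | false | false | _ = <ᵇ≡true⇒< i<K , ≮⇒≥ (λ j<K′ → subst T j<K (<⇒<ᵇ j<K′)) , refl

  cornerless : PathType → OrderedGraph (2 * K)
  cornerless t = record
    { adj    = λ x y → crossing t (toℕ x) (toℕ y) ∨ crossing t (toℕ y) (toℕ x)
    ; sym    = λ x y → ∨-comm (crossing t (toℕ x) (toℕ y)) _
    ; irrefl = λ x → cong₂ _∨_ (crossing-irrefl t (toℕ x)) (crossing-irrefl t (toℕ x)) }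

  cornerless-bipartite : ∀ t → BipartiteSplit K (cornerless t)
  cornerless-bipartite t x y xy with ∨-true⁻ {crossing t (toℕ x) (toℕ y)} xy
  ... | inj₁ c = inj₁ (proj₁ (crossing⇒ t _ _ c) , proj₁ (proj₂ (crossing⇒ t _ _ c)))
  ... | inj₂ c = inj₂ (proj₁ (crossing⇒ t _ _ c) , proj₁ (proj₂ (crossing⇒ t _ _ c)))

  biadjacency-cornerless : ∀ t a b → a < K → b < K → biadjacency K (cornerless t) a b ≡ not (corner t a b)
  biadjacency-cornerless t a b a<K b<K with a <? 2 * K | K + b <? 2 * K
  ... | no  a≮2K | _          = ⊥-elim (a≮2K (<-≤-trans a<K (m≤m+n K (K + 0))))
  ... | yes _    | no  K+b≮2K = ⊥-elim (K+b≮2K (subst (K + b <_) (sym (2*n≡n+n K)) (+-monoʳ-< K b<K)))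
  ... | yes a<2K | yes K+b<2K
    rewrite toℕ-fromℕ< a<2K | toℕ-fromℕ< K+b<2K
          | <⇒<ᵇ≡true a<K | ≮⇒<ᵇ≡false (m+n≮m K b) | m+n∸m≡n K b = ∨-identityʳ _

  count-cornerRow : ∀ t → ∑[ a < K ] 𝟙 (cornerRow t a) ≡ s
  count-cornerRow ll = count-< K s (m≤n+m s d)
  count-cornerRow gg = trans (count-≥ K d (m≤m+n d s)) (m+n∸m≡n d s)
  count-cornerRow lg = count-< K s (m≤n+m s d)
  count-cornerRow gl = trans (count-≥ K d (m≤m+n d s)) (m+n∸m≡n d s)

  count-cornerCol : ∀ t → ∑[ b < K ] 𝟙 (cornerCol t b) ≡ s
  count-cornerCol ll = count-cornerRow ll
  count-cornerCol gg = count-cornerRow gg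
  count-cornerCol lg = count-cornerRow gg
  count-cornerCol gl = count-cornerRow ll

  edgeCount-cornerless : ∀ t → edgeCount (cornerless t) ≡ d * (d + 2 * s)
  edgeCount-cornerless t = +-cancelʳ-≡ (s * s) _ _ (begin
    edgeCount (cornerless t) + s * s
      ≡⟨ cong (_+ s * s) (edgeCount-bipartite K (cornerless t) (cornerless-bipartite t)) ⟩
    ones K (biadjacency K (cornerless t)) + s * s
      ≡⟨ cong (_+ s * s) (∑-cong K (λ a a<K → ∑-cong K (λ b b<K →
           cong 𝟙 (biadjacency-cornerless t a b a<K b<K)))) ⟩
    ones K (λ a b → not (corner t a b)) + s * s
      ≡⟨ cong₂ (λ r c → ones K (λ a b → not (corner t a b)) + r * c) (count-cornerRow t) (count-cornerCol t) ⟨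
    ones K (λ a b → not (corner t a b)) + ∑[ a < K ] 𝟙 (cornerRow t a) * ∑[ b < K ] 𝟙 (cornerCol t b)
      ≡⟨ ones-not-rectangle K (cornerRow t) (cornerCol t) ⟩
    (d + s) * (d + s)
      ≡⟨ square-minus-corner d s ⟩
    d * (d + 2 * s) + s * s ∎)
    where
    open ≡-Reasoning
    square-minus-corner : ∀ d s → (d + s) * (d + s) ≡ d * (d + 2 * s) + s * s
    square-minus-corner = solve-∀

  -- In a copy of P_{2k}^t the first edge v₁v₂ lands in the corner: the other k - 1 vertices
  -- of each side all lie beyond v₁ (resp. v₂) in one direction, and there are only K places.
  module Copy (t : PathType) (F : Fin (2 * suc d) → Fin (2 * K))
           (F-increasing : ∀ a b → toℕ a < toℕ b → toℕ (F a) < toℕ (F b))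
           (F-edges : ∀ a b → PathEdge t (suc d) a b → adj (cornerless t) (F a) (F b) ≡ true) where

    k : ℕ
    k = suc d

    f : ℕ → ℕ
    f = extendℕ F

    f-increasing : Increasing (2 * k) f
    f-increasing = extendℕ-increasing F F-increasing

    Crosses : ℕ → ℕ → Set
    Crosses p q = f p < K × K ≤ f q × corner t (f p) (f q ∸ K) ≡ false

    left-position right-position : ℕ → ℕ
    left-position  i = leftIndex t k i
    right-position i = k + rightIndex t k i

    left<right : ∀ {i} → i < k → left-position i < right-position i
    left<right i<k = <-≤-trans (leftIndex<k t i<k) (m≤m+n k _)

    right<2k : ∀ {i} → i < k → right-position i < 2 * k
    right<2k {i} i<k = subst (right-position i <_) (sym (2*n≡n+n k)) (+-monoʳ-< k (rightIndex<k t i<k))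

    odd-edge-image : ∀ {i} → i < k →
      crossing t (f (left-position i)) (f (right-position i))
        ∨ crossing t (f (right-position i)) (f (left-position i)) ≡ true
    odd-edge-image {i} i<k =
      subst₂ (λ x y → crossing t x y ∨ crossing t y x ≡ true)
             (sym (extendℕ-fromℕ< F _ p<2k)) (sym (extendℕ-fromℕ< F _ (right<2k i<k))) (F-edges _ _ edge)
      where
      p<2k : left-position i < 2 * k
      p<2k = <-trans (left<right i<k) (right<2k i<k)
      edge : PathEdge t k (fromℕ< p<2k) (fromℕ< (right<2k i<k))
      edge = subst₂ (PathEdgeℕ t k) (cong (_+ 1) (sym (toℕ-fromℕ< p<2k)))
                                    (cong (_+ 1) (sym (toℕ-fromℕ< (right<2k i<k))))
                    (odd-pathEdge t i<k)

    odd-edge-crosses : ∀ {i} → i < k → Crosses (left-position i) (right-position i)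
    odd-edge-crosses i<k with ∨-true⁻ (odd-edge-image i<k)
    ... | inj₁ c = crossing⇒ t _ _ c
    ... | inj₂ c with crossing⇒ t _ _ c
    ...   | fq<K , K≤fp , _ =
      ⊥-elim (<-asym fq<K (≤-<-trans K≤fp (f-increasing (left<right i<k) (right<2k i<k))))

    crosses : ∀ {i p q} → i < k → left-position i ≡ p → right-position i ≡ q → Crosses p q
    crosses i<k refl refl = odd-edge-crosses i<k

    d<2k : d < 2 * k
    d<2k = <-≤-trans (n<1+n d) (m≤m+n k (k + 0))

    k+d<2k : k + d < 2 * k
    k+d<2k = subst (k + d <_) (sym (2*n≡n+n k)) (+-monoʳ-< k (n<1+n d))

    f0+d≤fd : f 0 + d ≤ f d
    f0+d≤fd = increasing⇒spread (2 * k) f f-increasing 0 d d<2k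

    fk+d≤fk+d : f k + d ≤ f (k + d)
    fk+d≤fk+d = increasing⇒spread (2 * k) f f-increasing k d k+d<2k

    initial-row : f d < K → initial (f 0) ≡ true
    initial-row fd<K = <⇒<ᵇ≡true (+-cancelʳ-< d (f 0) s (≤-<-trans f0+d≤fd (subst (f d <_) (+-comm d s) fd<K)))

    final-row : final (f d) ≡ true
    final-row = cong not (≮⇒<ᵇ≡false (≤⇒≯ (≤-trans (m≤n+m d (f 0)) f0+d≤fd)))

    initial-col : K ≤ f k → initial (f k ∸ K) ≡ true
    initial-col K≤fk = <⇒<ᵇ≡true (subst (f k ∸ K <_) (m+n∸m≡n K s) (∸-monoˡ-< fk<K+s K≤fk))
      where
      2K≡K+s+d : 2 * K ≡ K + s + d
      2K≡K+s+d = trans (2*n≡n+n K) (trans (cong (K +_) (+-comm d s)) (sym (+-assoc K s d)))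
      fk<K+s : f k < K + s
      fk<K+s = +-cancelʳ-< d (f k) (K + s)
                 (≤-<-trans fk+d≤fk+d (subst (f (k + d) <_) 2K≡K+s+d (extendℕ-bound F (k + d) k+d<2k)))

    final-col : K ≤ f k → final (f (k + d) ∸ K) ≡ true
    final-col K≤fk = cong not (≮⇒<ᵇ≡false (≤⇒≯ (m+n≤o⇒m≤o∸n d d+K≤fk+d)))
      where
      d+K≤fk+d : d + K ≤ f (k + d)
      d+K≤fk+d = subst (_≤ f (k + d)) (+-comm K d) (≤-trans (+-monoˡ-≤ d K≤fk) fk+d≤fk+d)

    corner-absurd : ∀ {x y} → cornerRow t x ≡ true → cornerCol t y ≡ true → corner t x y ≡ false → ⊥
    corner-absurd row col cor with trans (sym (cong₂ _∧_ row col)) cor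
    ... | ()

  cornerless-avoids : ∀ t → AvoidsPath (cornerless t) t (suc d)
  cornerless-avoids ll (F , F-increasing , F-edges) =
    corner-absurd (initial-row (proj₁ last)) (initial-col (proj₁ (proj₂ first))) (proj₂ (proj₂ first))
    where
    open Copy ll F F-increasing F-edges
    first : Crosses 0 k
    first = crosses z<s refl (+-identityʳ k)
    last : Crosses d (k + d)
    last = crosses (n<1+n d) refl refl
  cornerless-avoids gg (F , F-increasing , F-edges) =
    corner-absurd final-row (final-col (proj₁ (proj₂ last))) (proj₂ (proj₂ first))
    where
    open Copy gg F F-increasing F-edges
    first : Crosses d (k + d)
    first = crosses z<s refl refl
    last : Crosses 0 k
    last = crosses (n<1+n d) (n∸n≡0 d) (trans (cong (k +_) (n∸n≡0 d)) (+-identityʳ k))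
  cornerless-avoids lg (F , F-increasing , F-edges) =
    corner-absurd (initial-row (proj₁ last)) (final-col (proj₁ (proj₂ last))) (proj₂ (proj₂ first))
    where
    open Copy lg F F-increasing F-edges
    first : Crosses 0 (k + d)
    first = crosses z<s refl refl
    last : Crosses d k
    last = crosses (n<1+n d) refl (trans (cong (k +_) (n∸n≡0 d)) (+-identityʳ k))
  cornerless-avoids gl (F , F-increasing , F-edges) =
    corner-absurd final-row (initial-col (proj₁ (proj₂ first))) (proj₂ (proj₂ first))
    where
    open Copy gl F F-increasing F-edges
    first : Crosses d k
    first = crosses z<s refl (+-identityʳ k)

extremal-number : ∀ d s t → ExBipEquals (d + s) t (suc d) (d * (d + 2 * s))
extremal-number d s t =
  (cornerless t , cornerless-bipartite t , cornerless-avoids t , edgeCount-cornerless t) ,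
  avoids⇒edgeCount-≤ d s t
  where open Cornerless d s

2[d+s]+1∸[1+d]≡d+2s : ∀ d s → 2 * (d + s) + 1 ∸ suc d ≡ d + 2 * s
2[d+s]+1∸[1+d]≡d+2s d s = trans (cong (_∸ suc d) (regroup d s)) (m+n∸m≡n (suc d) (d + 2 * s))
  where
  regroup : ∀ d s → 2 * (d + s) + 1 ≡ suc d + (d + 2 * s)
  regroup = solve-∀

theorem4p1 : (k K : ℕ) → 1 ≤ k → k ≤ K → (t : PathType) →
    ExBipEquals K t k ((k ∸ 1) * (2 * K + 1 ∸ k))
theorem4p1 zero    K () _ _
theorem4p1 (suc d) K _ k≤K t with m≤n⇒∃[o]m+o≡n (<⇒≤ k≤K)
... | s , refl =
  subst (ExBipEquals (d + s) t (suc d)) (cong (d *_) (sym (2[d+s]+1∸[1+d]≡d+2s d s))) (extremal-number d s t)
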